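{- (i) The following 12 sequences form a ${\rm PSCA}(6,3,2)$: $123456, 154326, 216543, 245613, 354162, 361452, 423165, 461325, 516234, 532614, 632541, 645231$; and therefore $g(6,3)=2$. (ii) The following 12 sequences form a ${\rm PSCA}(7,3,2)$: $1234567, 1573426, 3275641, 3617524, 4261735, 4756123, 5164327, 5243176, 6257314, 6345721, 7216453, 7431625$; and therefore $g(7,3)=2$.
   Context: $S_n$ is the set of permutations of $[n]=\{1,\dots,n\}$, each written as the sequence of its values, and $S_{n,k}$ is the set of sequences of $k$ distinct elements of $[n]$. A sequence $x \in S_n$ covers $y \in S_{n,k}$ if $y$ is a (not necessarily contiguous) subsequence of $x$. A ${\rm PSCA}(n,k,\lambda)$ is a multiset $P$ of elements of $S_n$ such that every $y \in S_{n,k}$ is covered by exactly $\lambda$ elements of $P$, counted with multiplicity. $g(n,k)$ is the smallest positive integer $\lambda$ for which a ${\rm PSCA}(n,k,\lambda)$ exists. -}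

module Defs where

open import Data.Nat using (ℕ; _≤_; _<_)
open import Data.Nat.Properties using (_≟_)
open import Data.List using (List; []; _∷_; length; filter)
open import Data.List.Relation.Unary.All using (All)
open import Data.List.Relation.Unary.Unique.Propositional using (Unique)
open import Data.List.Relation.Binary.Sublist.Propositional using (_⊆_)
import Data.List.Relation.Binary.Sublist.DecPropositional as DecSub
open import Data.Product using (_×_; ∃)
open import Relation.Binary.PropositionalEquality using (_≡_)
open import Relation.Nullary using (¬_)

open DecSub _≟_ using (_⊆?_)

InRange : ℕ → ℕ → Set
InRange n i = 1 ≤ i × i ≤ n

IsSnk : ℕ → ℕ → List ℕ → Set
IsSnk n k y = length y ≡ k × Unique y × All (InRange n) y

IsSn : ℕ → List ℕ → Set
IsSn n x = IsSnk n n x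

Covers : List ℕ → List ℕ → Set
Covers x y = y ⊆ x

-- number of elements of the multiset P (a list) covering y, with multiplicity
coverCount : List (List ℕ) → List ℕ → ℕ
coverCount P y = length (filter (λ x → y ⊆? x) P)

IsPSCA : ℕ → ℕ → ℕ → List (List ℕ) → Set
IsPSCA n k l P = All (IsSn n) P × (∀ y → IsSnk n k y → coverCount P y ≡ l)

PSCAExists : ℕ → ℕ → ℕ → Set
PSCAExists n k l = ∃ λ (P : List (List ℕ)) → IsPSCA n k l P

gIs : ℕ → ℕ → ℕ → Set
gIs n k m = 1 ≤ m × PSCAExists n k m × (∀ l → 1 ≤ l → l < m → ¬ PSCAExists n k l)

P63 : List (List ℕ)
P63 =
  (1 ∷ 2 ∷ 3 ∷ 4 ∷ 5 ∷ 6 ∷ []) ∷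
  (1 ∷ 5 ∷ 4 ∷ 3 ∷ 2 ∷ 6 ∷ []) ∷
  (2 ∷ 1 ∷ 6 ∷ 5 ∷ 4 ∷ 3 ∷ []) ∷
  (2 ∷ 4 ∷ 5 ∷ 6 ∷ 1 ∷ 3 ∷ []) ∷
  (3 ∷ 5 ∷ 4 ∷ 1 ∷ 6 ∷ 2 ∷ []) ∷
  (3 ∷ 6 ∷ 1 ∷ 4 ∷ 5 ∷ 2 ∷ []) ∷
  (4 ∷ 2 ∷ 3 ∷ 1 ∷ 6 ∷ 5 ∷ []) ∷
  (4 ∷ 6 ∷ 1 ∷ 3 ∷ 2 ∷ 5 ∷ []) ∷
  (5 ∷ 1 ∷ 6 ∷ 2 ∷ 3 ∷ 4 ∷ []) ∷
  (5 ∷ 3 ∷ 2 ∷ 6 ∷ 1 ∷ 4 ∷ []) ∷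
  (6 ∷ 3 ∷ 2 ∷ 5 ∷ 4 ∷ 1 ∷ []) ∷
  (6 ∷ 4 ∷ 5 ∷ 2 ∷ 3 ∷ 1 ∷ []) ∷ []

P73 : List (List ℕ)
P73 =
  (1 ∷ 2 ∷ 3 ∷ 4 ∷ 5 ∷ 6 ∷ 7 ∷ []) ∷
  (1 ∷ 5 ∷ 7 ∷ 3 ∷ 4 ∷ 2 ∷ 6 ∷ []) ∷
  (3 ∷ 2 ∷ 7 ∷ 5 ∷ 6 ∷ 4 ∷ 1 ∷ []) ∷
  (3 ∷ 6 ∷ 1 ∷ 7 ∷ 5 ∷ 2 ∷ 4 ∷ []) ∷
  (4 ∷ 2 ∷ 6 ∷ 1 ∷ 7 ∷ 3 ∷ 5 ∷ []) ∷
  (4 ∷ 7 ∷ 5 ∷ 6 ∷ 1 ∷ 2 ∷ 3 ∷ []) ∷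
  (5 ∷ 1 ∷ 6 ∷ 4 ∷ 3 ∷ 2 ∷ 7 ∷ []) ∷
  (5 ∷ 2 ∷ 4 ∷ 3 ∷ 1 ∷ 7 ∷ 6 ∷ []) ∷
  (6 ∷ 2 ∷ 5 ∷ 7 ∷ 3 ∷ 1 ∷ 4 ∷ []) ∷
  (6 ∷ 3 ∷ 4 ∷ 5 ∷ 7 ∷ 2 ∷ 1 ∷ []) ∷
  (7 ∷ 2 ∷ 1 ∷ 6 ∷ 4 ∷ 5 ∷ 3 ∷ []) ∷
  (7 ∷ 4 ∷ 3 ∷ 1 ∷ 6 ∷ 2 ∷ 5 ∷ []) ∷ []

-- Both arrays are verified by exhaustive computation over S_{n,3}.  For g(n,3) ≥ 2 with n ≥ 5,
-- suppose P is a PSCA(n,3,1) and restrict every member of P to [5], giving a permutation of [5].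
-- If d ∈ [5] stands at position p (0-based) of such a restriction, the permutation covers
-- C(4-p,2) triples of S_{5,3} beginning with d and p(4-p) triples with d in the middle.  Each of
-- these two families has 12 members, each covered exactly once, so with N_j the number of members
-- of P in which d is at position j,
--   6 N₀ + 3 N₁ + N₂ = 12   and   3 N₁ + 4 N₂ + 3 N₃ = 12.
-- The first gives 3 ∣ N₂, the second N₂ ≤ 3, and N₂ = 3 would force N₁ = 0 and 6 N₀ = 9.  Hence no
-- d ∈ [5] ever occupies the middle position, which is absurd as P is non-empty.
module Submission where

open import Defs
import Algebra.Properties.CommutativeSemigroup as CommutativeSemigroupProperties
open import Data.List
  using (List; []; _∷_; _++_; length; map; filter; concatMap; applyUpTo; takeWhile; head; drop)
open import Data.List.Membership.Propositional using (_∈_; _∉_; find)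
open import Data.List.Membership.Propositional.Properties
  using ( ∈-∃++; ∈-++⁻; ∈-++⁺ˡ; ∈-++⁺ʳ; ∈-map⁺; ∈-map⁻; ∈-concatMap⁺; ∈-concatMap⁻
        ; ∈-filter⁺; ∈-filter⁻; ∈-applyUpTo⁺; ∈-applyUpTo⁻)
open import Data.List.Properties
  using (map-∘; map-cong; map-cong-local; length-++-sucʳ; length-applyUpTo; filter-all)
open import Data.List.Relation.Binary.Sublist.Propositional using (⊆-trans)
open import Data.List.Relation.Binary.Sublist.Propositional.Properties
  using (filter-⊆) renaming (filter⁺ to Sublist-filter⁺)
import Data.List.Relation.Binary.Sublist.DecPropositional as DecSublist
import Data.List.Relation.Binary.Subset.Propositional as Subset
open import Data.List.Relation.Unary.All as All using (All; []; _∷_; all?)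
open import Data.List.Relation.Unary.All.Properties
  using (all-filter; ¬Any⇒All¬; All¬⇒¬Any) renaming (filter⁺ to All-filter⁺)
open import Data.List.Relation.Unary.Any as Any using (Any; here; there; any?)
open import Data.List.Relation.Unary.Unique.Propositional using (Unique; []; _∷_)
open import Data.List.Relation.Unary.Unique.Propositional.Properties
  using (applyUpTo⁺₁) renaming (filter⁺ to Unique-filter⁺)
open import Data.Maybe using (just)
import Data.Maybe.Properties as Maybe
open import Data.Nat
open import Data.Nat.Combinatorics using (_C_)
open import Data.Nat.Divisibility using (_∣_; _∣?_; divides; ∣m∣n⇒∣m+n; ∣m+n∣m⇒∣n; ∣m⇒∣m*n; m∣m*n)
open import Data.Nat.ListAction using (sum)
open import Data.Nat.Properties
open import Data.Product using (_×_; _,_; proj₁; proj₂)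
open import Data.Sum using (inj₁; inj₂)
open import Function using (_∘_; id)
open import Relation.Nullary using (Dec; yes; no; ¬_; ¬?; contradiction)
open import Relation.Nullary.Decidable using (_×-dec_; map′; from-yes; from-no)
open import Relation.Unary using (Decidable)
open import Relation.Binary.PropositionalEquality
  using (_≡_; refl; sym; trans; cong; cong₂; subst; module ≡-Reasoning)

open DecSublist _≟_ using (_⊆?_)
open import Data.List.Membership.DecPropositional _≟_ using (_∈?_; _∉?_)
open import Data.List.Relation.Unary.Unique.DecPropositional _≟_ using (unique?)
open CommutativeSemigroupProperties +-commutativeSemigroup using (interchange)

private
  variable
    A B : Set
    n m k : ℕ
    x y : List ℕ

indicator : Dec A → ℕ
indicator (yes _) = 1
indicator (no _)  = 0

indicator-cong : (a? : Dec A) (b? : Dec B) → (A → B) → (B → A) → indicator a? ≡ indicator b?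
indicator-cong (yes _) (yes _) _ _ = refl
indicator-cong (no _)  (no _)  _ _ = refl
indicator-cong (yes a) (no ¬b) f _ = contradiction (f a) ¬b
indicator-cong (no ¬a) (yes b) _ g = contradiction (g b) ¬a

sum-map-+ : ∀ (f g : A → ℕ) xs → sum (map (λ a → f a + g a) xs) ≡ sum (map f xs) + sum (map g xs)
sum-map-+ f g []       = refl
sum-map-+ f g (a ∷ xs) = trans (cong (f a + g a +_) (sum-map-+ f g xs)) (interchange (f a) (g a) _ _)

sum-map-*ˡ : ∀ c (f : A → ℕ) xs → sum (map (λ a → c * f a) xs) ≡ c * sum (map f xs)
sum-map-*ˡ c f []       = sym (*-zeroʳ c)
sum-map-*ˡ c f (a ∷ xs) = trans (cong (c * f a +_) (sum-map-*ˡ c f xs)) (sym (*-distribˡ-+ c (f a) _))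

sum-map-linear : ∀ a b (f g h : A → ℕ) xs →
                 sum (map (λ x → a * f x + b * g x + h x) xs) ≡
                 a * sum (map f xs) + b * sum (map g xs) + sum (map h xs)
sum-map-linear a b f g h xs = begin
  sum (map (λ x → a * f x + b * g x + h x) xs)
    ≡⟨ sum-map-+ _ h xs ⟩
  sum (map (λ x → a * f x + b * g x) xs) + sum (map h xs)
    ≡⟨ cong (_+ sum (map h xs)) (sum-map-+ _ _ xs) ⟩
  sum (map (λ x → a * f x) xs) + sum (map (λ x → b * g x) xs) + sum (map h xs)
    ≡⟨ cong (_+ sum (map h xs)) (cong₂ _+_ (sum-map-*ˡ a f xs) (sum-map-*ˡ b g xs)) ⟩
  a * sum (map f xs) + b * sum (map g xs) + sum (map h xs)
    ∎
  where open ≡-Reasoning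

sum-map-const : ∀ {f : A → ℕ} {c xs} → All (λ a → f a ≡ c) xs → sum (map f xs) ≡ length xs * c
sum-map-const []         = refl
sum-map-const (fa≡c ∷ p) = cong₂ _+_ fa≡c (sum-map-const p)

sum-map-swap : ∀ (f : A → B → ℕ) as bs →
               sum (map (λ a → sum (map (f a) bs)) as) ≡ sum (map (λ b → sum (map (λ a → f a b) as)) bs)
sum-map-swap f []       bs = sym (trans (sum-map-const (All.universal (λ _ → refl) bs)) (*-zeroʳ (length bs)))
sum-map-swap f (a ∷ as) bs =
  trans (cong (sum (map (f a) bs) +_) (sum-map-swap f as bs)) (sym (sum-map-+ (f a) _ bs))

≤-sum-map : ∀ (f : A → ℕ) {a xs} → a ∈ xs → f a ≤ sum (map f xs)
≤-sum-map f {xs = b ∷ xs} (here refl)  = m≤m+n (f b) _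
≤-sum-map f {xs = b ∷ xs} (there a∈xs) = ≤-trans (≤-sum-map f a∈xs) (m≤n+m _ (f b))

length-filter≡sum : ∀ {P : A → Set} (P? : Decidable P) xs →
                    length (filter P? xs) ≡ sum (map (indicator ∘ P?) xs)
length-filter≡sum P? []       = refl
length-filter≡sum P? (a ∷ xs) with P? a
... | yes _ = cong suc (length-filter≡sum P? xs)
... | no _  = length-filter≡sum P? xs

range : ℕ → List ℕ
range = applyUpTo suc

∈-range⁺ : ∀ {i} → InRange n i → i ∈ range n
∈-range⁺ {i = suc i} (_ , i<n) = ∈-applyUpTo⁺ suc i<n

∈-range⁻ : ∀ {i} → i ∈ range n → InRange n i
∈-range⁻ i∈[n] with j , j<n , refl ← ∈-applyUpTo⁻ suc i∈[n] = s≤s z≤n , j<n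

range-unique : ∀ n → Unique (range n)
range-unique n = applyUpTo⁺₁ suc n (λ i<j _ → <⇒≢ i<j ∘ suc-injective)

Unique-length-≤ : ∀ {xs ys : List A} → Unique xs → xs Subset.⊆ ys → length xs ≤ length ys
Unique-length-≤ {xs = []} _ _ = z≤n
Unique-length-≤ {xs = a ∷ xs} (a∉xs ∷ xs!) a∷xs⊆ys
  with us , vs , refl ← ∈-∃++ (a∷xs⊆ys (here refl)) =
  subst (suc (length xs) ≤_) (sym (length-++-sucʳ us a vs)) (s≤s (Unique-length-≤ xs! xs⊆us++vs))
  where
  xs⊆us++vs : xs Subset.⊆ us ++ vs
  xs⊆us++vs b∈xs with ∈-++⁻ us (a∷xs⊆ys (there b∈xs))
  ... | inj₁ b∈us         = ∈-++⁺ˡ b∈us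
  ... | inj₂ (here refl)  = contradiction refl (All.lookup a∉xs b∈xs)
  ... | inj₂ (there b∈vs) = ∈-++⁺ʳ us b∈vs

IsSn⇒∈ : ∀ {i} → IsSn n x → InRange n i → i ∈ x
IsSn⇒∈ {n} {x} {i} (|x|≡n , x! , x⊆[n]) i∈[n] with i ∈? x
... | yes i∈x = i∈x
... | no  i∉x = contradiction (Unique-length-≤ (¬Any⇒All¬ x i∉x ∷ x!) i∷x⊆[n])
                  (subst (λ l → ¬ suc l ≤ length (range n)) (sym |x|≡n)
                         (<-irrefl (sym (length-applyUpTo suc n))))
  where
  i∷x⊆[n] : (i ∷ x) Subset.⊆ range n
  i∷x⊆[n] (here refl) = ∈-range⁺ i∈[n]
  i∷x⊆[n] (there j∈x) = ∈-range⁺ (All.lookup x⊆[n] j∈x)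

restrict : ℕ → List ℕ → List ℕ
restrict m = filter (_≤? m)

restrict-IsSn : m ≤ n → IsSn n x → IsSn m (restrict m x)
restrict-IsSn {m} {n} {x} m≤n x∈Sₙ@(_ , x! , x⊆[n]) =
  ≤-antisym upper lower , Unique-filter⁺ (_≤? m) x! , x|m⊆[m]
  where
  x|m⊆[m] : All (InRange m) (restrict m x)
  x|m⊆[m] = All.zipWith (λ { ((1≤i , _) , i≤m) → 1≤i , i≤m })
                        (All-filter⁺ (_≤? m) x⊆[n] , all-filter (_≤? m) x)

  upper : length (restrict m x) ≤ m
  upper = subst (length (restrict m x) ≤_) (length-applyUpTo suc m)
                (Unique-length-≤ (Unique-filter⁺ (_≤? m) x!) (∈-range⁺ ∘ All.lookup x|m⊆[m]))

  [m]⊆x|m : range m Subset.⊆ restrict m x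
  [m]⊆x|m i∈[m] with 1≤i , i≤m ← ∈-range⁻ i∈[m] =
    ∈-filter⁺ (_≤? m) (IsSn⇒∈ x∈Sₙ (1≤i , ≤-trans i≤m m≤n)) i≤m

  lower : m ≤ length (restrict m x)
  lower = subst (_≤ length (restrict m x)) (length-applyUpTo suc m)
                (Unique-length-≤ (range-unique m) [m]⊆x|m)

IsSnk-mono : m ≤ n → IsSnk m k y → IsSnk n k y
IsSnk-mono m≤n (|y|≡k , y! , y⊆[m]) =
  |y|≡k , y! , All.map (λ { (1≤i , i≤m) → 1≤i , ≤-trans i≤m m≤n }) y⊆[m]

isSnk? : ∀ n k → Decidable (IsSnk n k)
isSnk? n k y = (length y ≟ k) ×-dec unique? y ×-dec all? (λ i → (1 ≤? i) ×-dec (i ≤? n)) y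

extensions : ℕ → List ℕ → List (List ℕ)
extensions n y = map (_∷ y) (filter (_∉? y) (range n))

arrangements : ℕ → ℕ → List (List ℕ)
arrangements n zero    = [] ∷ []
arrangements n (suc k) = concatMap (extensions n) (arrangements n k)

∈-extensions⁺ : ∀ {i} → InRange n i → i ∉ y → i ∷ y ∈ extensions n y
∈-extensions⁺ {y = y} i∈[n] i∉y = ∈-map⁺ (_∷ y) (∈-filter⁺ (_∉? y) (∈-range⁺ i∈[n]) i∉y)

∈-arrangements⁺ : IsSnk n k y → y ∈ arrangements n k
∈-arrangements⁺ {y = []} (refl , _ , _) = here refl
∈-arrangements⁺ {n = n} {y = i ∷ y} (refl , i∉y ∷ y! , i∈[n] ∷ y⊆[n]) =
  ∈-concatMap⁺ (extensions n)
    (Any.map (λ { refl → ∈-extensions⁺ i∈[n] (All¬⇒¬Any i∉y) }) (∈-arrangements⁺ (refl , y! , y⊆[n])))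

∈-arrangements⁻ : y ∈ arrangements n k → IsSnk n k y
∈-arrangements⁻ {k = zero} (here refl) = refl , [] , []
∈-arrangements⁻ {n = n} {k = suc k} y∈
  with z , z∈ , y∈ext ← find (∈-concatMap⁻ (extensions n) {xs = arrangements n k} y∈)
  with i , i∈ , refl ← ∈-map⁻ (_∷ z) y∈ext
  with i∈[n] , i∉z ← ∈-filter⁻ (_∉? z) i∈
  with refl , z! , z⊆[n] ← ∈-arrangements⁻ {k = k} z∈ =
  refl , ¬Any⇒All¬ z i∉z ∷ z! , ∈-range⁻ i∈[n] ∷ z⊆[n]

∀-IsSnk? : ∀ n k {Q : List ℕ → Set} → Decidable Q → Dec (∀ y → IsSnk n k y → Q y)
∀-IsSnk? n k Q? = map′ (λ all y y∈Snk → All.lookup all (∈-arrangements⁺ y∈Snk))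
                       (λ h → All.tabulate (λ y∈ → h _ (∈-arrangements⁻ y∈)))
                       (all? Q? (arrangements n k))

isPSCA? : ∀ n k l P → Dec (IsPSCA n k l P)
isPSCA? n k l P = all? (isSnk? n n) P ×-dec ∀-IsSnk? n k (λ y → coverCount P y ≟ l)

coveredIn : List (List ℕ) → List ℕ → ℕ
coveredIn T x = sum (map (λ y → indicator (y ⊆? x)) T)

sum-coveredIn : ∀ {l P T} → IsPSCA n k l P → All (IsSnk n k) T →
                sum (map (coveredIn T) P) ≡ length T * l
sum-coveredIn {l = l} {P} {T} (_ , cover) T⊆Snk = begin
  sum (map (coveredIn T) P)
    ≡⟨ sum-map-swap (λ x y → indicator (y ⊆? x)) P T ⟩
  sum (map (λ y → sum (map (λ x → indicator (y ⊆? x)) P)) T)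
    ≡⟨ cong sum (map-cong (λ y → length-filter≡sum (y ⊆?_) P) T) ⟨
  sum (map (coverCount P) T)
    ≡⟨ sum-map-const (All.map (cover _) T⊆Snk) ⟩
  length T * l
    ∎
  where open ≡-Reasoning

Covers-restrict⁺ : All (_≤ m) y → Covers x y → Covers (restrict m x) y
Covers-restrict⁺ {m} {y} y≤m y⊆x =
  subst (Covers _) (filter-all (_≤? m) y≤m) (Sublist-filter⁺ (_≤? m) (_≤? m) (λ { refl → id }) y⊆x)

Covers-restrict⁻ : Covers (restrict m x) y → Covers x y
Covers-restrict⁻ {m} {x} y⊆x|m = ⊆-trans y⊆x|m (filter-⊆ (_≤? m) x)

coveredIn-restrict : ∀ {T} → All (All (_≤ m)) T → coveredIn T (restrict m x) ≡ coveredIn T x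
coveredIn-restrict {m} {x} T≤m = cong sum (map-cong-local (All.map indicators-agree T≤m))
  where
  indicators-agree : ∀ {y} → All (_≤ m) y → indicator (y ⊆? restrict m x) ≡ indicator (y ⊆? x)
  indicators-agree {y} y≤m = indicator-cong (y ⊆? restrict m x) (y ⊆? x) Covers-restrict⁻ (Covers-restrict⁺ y≤m)

position : ℕ → List ℕ → ℕ
position d = length ∘ takeWhile (λ a → ¬? (a ≟ d))

pairsAfter pairsAround : ℕ → ℕ
pairsAfter  p = (4 ∸ p) C 2
pairsAround p = p * (4 ∸ p)

hasEntry? : ∀ i d → Decidable (λ (y : List ℕ) → head (drop i y) ≡ just d)
hasEntry? i d y = Maybe.≡-dec _≟_ (head (drop i y)) (just d)

triplesAt : ℕ → ℕ → List (List ℕ)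
triplesAt i d = filter (hasEntry? i d) (arrangements 5 3)

triplesAt-IsSnk : ∀ i d → All (IsSnk 5 3) (triplesAt i d)
triplesAt-IsSnk i d = All.tabulate (∈-arrangements⁻ ∘ proj₁ ∘ ∈-filter⁻ (hasEntry? i d))

-- The families are parameters rather than 'triplesAt 0 d' and 'triplesAt 1 d' so that the
-- exhaustive check below computes each of them once per d instead of once per σ.
TriplesProfile : ℕ → List (List ℕ) → List (List ℕ) → Set
TriplesProfile d T₀ T₁ =
  length T₀ ≡ 12 × length T₁ ≡ 12 ×
  (∀ σ → IsSn 5 σ → coveredIn T₀ σ ≡ pairsAfter (position d σ) × coveredIn T₁ σ ≡ pairsAround (position d σ))

triplesProfile? : ∀ d T₀ T₁ → Dec (TriplesProfile d T₀ T₁)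
triplesProfile? d T₀ T₁ =
  (length T₀ ≟ 12) ×-dec (length T₁ ≟ 12) ×-dec
  ∀-IsSnk? 5 5 (λ σ → (coveredIn T₀ σ ≟ pairsAfter (position d σ)) ×-dec
                      (coveredIn T₁ σ ≟ pairsAround (position d σ)))

triplesProfile : All (λ d → TriplesProfile d (triplesAt 0 d) (triplesAt 1 d)) (range 5)
triplesProfile = from-yes (all? (λ d → triplesProfile? d (triplesAt 0 d) (triplesAt 1 d)) (range 5))

middle-exists : ∀ σ → IsSn 5 σ → Any (λ d → position d σ ≡ 2) (range 5)
middle-exists = from-yes (∀-IsSnk? 5 5 (λ σ → any? (λ d → position d σ ≟ 2) (range 5)))

δ : ℕ → ℕ → ℕ
δ j p = indicator (p ≟ j)

pairsAfter-δ : ∀ p → pairsAfter p ≡ 6 * δ 0 p + 3 * δ 1 p + δ 2 p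
pairsAfter-δ 0 = refl
pairsAfter-δ 1 = refl
pairsAfter-δ 2 = refl
pairsAfter-δ 3 = refl
pairsAfter-δ (suc (suc (suc (suc q)))) = cong (_C 2) (0∸n≡0 q)

pairsAround-δ : ∀ p → pairsAround p ≡ 3 * δ 1 p + 4 * δ 2 p + 3 * δ 3 p
pairsAround-δ 0 = refl
pairsAround-δ 1 = refl
pairsAround-δ 2 = refl
pairsAround-δ 3 = refl
pairsAround-δ p@(suc (suc (suc (suc q)))) = trans (cong (p *_) (0∸n≡0 q)) (*-zeroʳ p)

6a+3b+c≡12⇒3∣c : ∀ a b c → 6 * a + 3 * b + c ≡ 12 → 3 ∣ c
6a+3b+c≡12⇒3∣c a b c eq =
  ∣m+n∣m⇒∣n (subst (3 ∣_) (sym eq) (divides 4 refl)) (∣m∣n⇒∣m+n (∣m⇒∣m*n a (divides 2 refl)) (m∣m*n b))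

middle-count-zero : ∀ a b c e → 6 * a + 3 * b + c ≡ 12 → 3 * b + 4 * c + e ≡ 12 → c ≡ 0
middle-count-zero a b 0 e _     _      = refl
middle-count-zero a b 1 e after _      = contradiction (6a+3b+c≡12⇒3∣c a b 1 after) (from-no (3 ∣? 1))
middle-count-zero a b 2 e after _      = contradiction (6a+3b+c≡12⇒3∣c a b 2 after) (from-no (3 ∣? 2))
middle-count-zero a b 3 e after around = contradiction (∣m+n∣m⇒∣n 2∣6a+3b+3 2∣6a+3b) (from-no (2 ∣? 3))
  where
  b≡0 : b ≡ 0
  b≡0 = m+n≡0⇒m≡0 b (n≤0⇒n≡0 (m+n≤o⇒m≤o∸n (3 * b) (m+n≤o⇒m≤o (3 * b + 12) (≤-reflexive around))))

  2∣6a+3b+3 : 2 ∣ 6 * a + 3 * b + 3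
  2∣6a+3b+3 = subst (2 ∣_) (sym after) (divides 6 refl)

  2∣6a+3b : 2 ∣ 6 * a + 3 * b
  2∣6a+3b = subst (λ b → 2 ∣ 6 * a + 3 * b) (sym b≡0) (∣m∣n⇒∣m+n (∣m⇒∣m*n a (divides 3 refl)) (divides 0 refl))
middle-count-zero a b c@(suc (suc (suc (suc _)))) e _ around =
  contradiction (*-cancelˡ-≤ {c} {3} 4 4c≤12) λ { (s≤s (s≤s (s≤s ()))) }
  where
  4c≤12 : 4 * c ≤ 4 * 3
  4c≤12 = m+n≤o⇒n≤o (3 * b) (m+n≤o⇒m≤o (3 * b + 4 * c) (≤-reflexive around))

middle-position-absent : ∀ ps → sum (map pairsAfter ps) ≡ 12 → sum (map pairsAround ps) ≡ 12 → 2 ∉ ps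
middle-position-absent ps Σafter Σaround 2∈ps =
  contradiction (subst (1 ≤_) N₂≡0 (≤-sum-map (δ 2) 2∈ps)) λ ()
  where
  N : ℕ → ℕ
  N j = sum (map (δ j) ps)

  Σafter-δ : sum (map pairsAfter ps) ≡ 6 * N 0 + 3 * N 1 + N 2
  Σafter-δ = trans (cong sum (map-cong pairsAfter-δ ps)) (sum-map-linear 6 3 (δ 0) (δ 1) (δ 2) ps)

  Σaround-δ : sum (map pairsAround ps) ≡ 3 * N 1 + 4 * N 2 + sum (map (λ p → 3 * δ 3 p) ps)
  Σaround-δ = trans (cong sum (map-cong pairsAround-δ ps)) (sum-map-linear 3 4 (δ 1) (δ 2) _ ps)

  N₂≡0 : N 2 ≡ 0
  N₂≡0 = middle-count-zero (N 0) (N 1) (N 2) _ (trans (sym Σafter-δ) Σafter) (trans (sym Σaround-δ) Σaround)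

module _ (5≤n : 5 ≤ n) {P} (psca : IsPSCA n 3 1 P) {d} (d∈[5] : InRange 5 d) where

  positions : List ℕ
  positions = map (position d ∘ restrict 5) P

  sum-map-positions : ∀ {T} (f : ℕ → ℕ) → All (IsSnk 5 3) T → length T ≡ 12 →
                      (∀ σ → IsSn 5 σ → coveredIn T σ ≡ f (position d σ)) → sum (map f positions) ≡ 12
  sum-map-positions {T} f T⊆S₅₃ |T|≡12 profile = begin
    sum (map f positions)
      ≡⟨ cong sum (map-∘ P) ⟨
    sum (map (f ∘ position d ∘ restrict 5) P)
      ≡⟨ cong sum (map-cong-local (All.map (λ x∈Sₙ → sym (profile _ (restrict-IsSn 5≤n x∈Sₙ))) (proj₁ psca))) ⟩
    sum (map (coveredIn T ∘ restrict 5) P)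
      ≡⟨ cong sum (map-cong (λ _ → coveredIn-restrict (All.map (All.map proj₂ ∘ proj₂ ∘ proj₂) T⊆S₅₃)) P) ⟩
    sum (map (coveredIn T) P)
      ≡⟨ sum-coveredIn psca (All.map (IsSnk-mono 5≤n) T⊆S₅₃) ⟩
    length T * 1
      ≡⟨ cong (_* 1) |T|≡12 ⟩
    12
      ∎
    where open ≡-Reasoning

  middle-absent : 2 ∉ positions
  middle-absent =
    let |T₀| , |T₁| , profile = All.lookup triplesProfile (∈-range⁺ d∈[5])
    in middle-position-absent positions
         (sum-map-positions pairsAfter  (triplesAt-IsSnk 0 d) |T₀| (λ σ σ∈S₅ → proj₁ (profile σ σ∈S₅)))
         (sum-map-positions pairsAround (triplesAt-IsSnk 1 d) |T₁| (λ σ σ∈S₅ → proj₂ (profile σ σ∈S₅)))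

no-PSCA-3-1 : 5 ≤ n → ¬ PSCAExists n 3 1
no-PSCA-3-1 5≤n ([] , _ , cover) =
  contradiction (cover _ (IsSnk-mono 5≤n (from-yes (isSnk? 5 3 (1 ∷ 2 ∷ 3 ∷ []))))) λ ()
no-PSCA-3-1 5≤n (P@(x ∷ _) , psca@(x∈Sₙ ∷ _ , _)) =
  let d , d∈[5] , middle = find (middle-exists (restrict 5 x) (restrict-IsSn 5≤n x∈Sₙ))
  in middle-absent 5≤n psca (∈-range⁻ d∈[5]) (subst (_∈ map (position d ∘ restrict 5) P) middle (here refl))

gIs-2 : 5 ≤ n → PSCAExists n 3 2 → gIs n 3 2
gIs-2 5≤n psca = s≤s z≤n , psca , λ { 0 () _ ; 1 _ _ → no-PSCA-3-1 5≤n ; (suc (suc _)) _ (s≤s (s≤s ())) }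

proposition3p1 : (IsPSCA 6 3 2 P63 × gIs 6 3 2) × (IsPSCA 7 3 2 P73 × gIs 7 3 2)
proposition3p1 = (psca₆ , gIs-2 (m≤m+n 5 1) (P63 , psca₆)) , (psca₇ , gIs-2 (m≤m+n 5 2) (P73 , psca₇))
  where
  psca₆ : IsPSCA 6 3 2 P63
  psca₆ = from-yes (isPSCA? 6 3 2 P63)

  psca₇ : IsPSCA 7 3 2 P73
  psca₇ = from-yes (isPSCA? 7 3 2 P73)
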